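{- Let $T$ be a tree with $n(T)\ge 3$ vertices and let $k\in\{2,3,\ldots,n(T)-1\}$. Then ${\rm sgp}_k(T)=\ell(T)$ if $k\le \ell(T)$, and ${\rm sgp}_k(T)=k$ if $k>\ell(T)$.
   Context: $n(T)$ is the number of vertices of $T$ and $\ell(T)$ is the number of leaves of $T$. For a nonempty $W\subseteq V(G)$ of a graph $G$, the Steiner distance $d_G(W)$ is the minimum number of edges of a connected subgraph of $G$ containing $W$; such a minimum subgraph is a tree, called a Steiner $W$-tree. For a positive integer $k$, a set $A\subseteq V(G)$ is a $k$-Steiner general position set if for every $B\subseteq A$ with $|B|=k$ and every Steiner $B$-tree $T_B$ we have $V(T_B)\cap A=B$. ${\rm sgp}_k(G)$ is the largest cardinality of a $k$-Steiner general position set of $G$. -}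

module Defs where

open import Data.Nat using (ℕ; zero; suc; _+_; _≤_; _<_; _<ᵇ_; _≡ᵇ_)
open import Data.Bool using (Bool; true; false; _∧_; if_then_else_)
open import Data.Fin using (Fin; toℕ)
open import Data.Fin.Subset using (Subset; _∈_; _⊆_; _∩_; ∣_∣)
open import Data.List using (List; []; _∷_; _++_; [_]; length; map; allFin)
open import Data.Nat.ListAction using (sum)
open import Data.List.Relation.Unary.Linked using (Linked)
open import Data.List.Relation.Unary.Unique.Propositional using (Unique)
open import Data.Product using (Σ; _×_)
open import Relation.Binary.PropositionalEquality using (_≡_)
open import Relation.Binary.Construct.Closure.ReflexiveTransitive using (Star)

record Graph (n : ℕ) : Set where
  field
    adj    : Fin n → Fin n → Bool
    sym    : ∀ i j → adj i j ≡ adj j i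
    irrefl : ∀ i → adj i i ≡ false
open Graph public

Adj : ∀ {n} → Graph n → Fin n → Fin n → Set
Adj G i j = adj G i j ≡ true

Connected : ∀ {n} → Graph n → Set
Connected G = ∀ u v → Star (Adj G) u v

HasCycle : ∀ {n} → Graph n → Set
HasCycle {n} G = Σ (Fin n) λ x → Σ (List (Fin n)) λ xs →
  (2 ≤ length xs) × Unique (x ∷ xs) × Linked (Adj G) (x ∷ xs ++ [ x ])

IsTree : ∀ {n} → Graph n → Set
IsTree G = Connected G × (HasCycle G → Data.Empty.⊥)
  where import Data.Empty

b2n : Bool → ℕ
b2n true  = 1
b2n false = 0

degree : ∀ {n} → Graph n → Fin n → ℕ
degree {n} G v = sum (map (λ w → b2n (adj G v w)) (allFin n))

leaves : ∀ {n} → Graph n → ℕ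
leaves {n} G = sum (map (λ v → b2n (degree G v ≡ᵇ 1)) (allFin n))

record Subgraph {n : ℕ} (G : Graph n) : Set where
  field
    verts    : Subset n
    edge     : Fin n → Fin n → Bool
    edge-sym : ∀ i j → edge i j ≡ edge j i
    edge-adj : ∀ i j → edge i j ≡ true → adj G i j ≡ true
    edge-in  : ∀ i j → edge i j ≡ true → i ∈ verts
open Subgraph public

edgeCount : ∀ {n} {G : Graph n} → Subgraph G → ℕ
edgeCount {n} H = sum (map (λ i → sum (map (λ j →
  b2n ((toℕ i <ᵇ toℕ j) ∧ edge H i j)) (allFin n))) (allFin n))

SubConnected : ∀ {n} {G : Graph n} → Subgraph G → Set
SubConnected H = ∀ u v → u ∈ verts H → v ∈ verts H →
  Star (λ i j → edge H i j ≡ true) u v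

ConnContaining : ∀ {n} {G : Graph n} → Subset n → Subgraph G → Set
ConnContaining W H = SubConnected H × (W ⊆ verts H)

IsSteinerTree : ∀ {n} (G : Graph n) → Subset n → Subgraph G → Set
IsSteinerTree G W H = ConnContaining W H ×
  (∀ (H' : Subgraph G) → ConnContaining W H' → edgeCount H ≤ edgeCount H')

IsSGPSet : ∀ {n} → ℕ → Graph n → Subset n → Set
IsSGPSet {n} k G A = ∀ (B : Subset n) → B ⊆ A → ∣ B ∣ ≡ k →
  ∀ (T : Subgraph G) → IsSteinerTree G B T → verts T ∩ A ≡ B

IsSgp : ∀ {n} → ℕ → Graph n → ℕ → Set
IsSgp {n} k G m = (Σ (Subset n) λ A → IsSGPSet k G A × ∣ A ∣ ≡ m) ×
  (∀ (A : Subset n) → IsSGPSet k G A → ∣ A ∣ ≤ m)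

{-# OPTIONS --safe #-}

-- The leaves of T form a k-Steiner general position set for every k ≥ 1: a Steiner tree for a set
-- B of leaves contains no further leaf, since deleting it would leave a smaller connected subgraph
-- containing B; and any k-set is one trivially. Conversely, let A be a k-Steiner general position
-- set with |A| > k ≥ 2. No a ∈ A separates two other members u, w of A: extend {u, w} to a k-subset
-- of A ∖ {a}; its Steiner tree contains the u–w path, hence a. So A ∖ {a} lies in a single branch
-- of T at a, and a leaf in another branch (or a itself, if it is a leaf) is separated by a from
-- A ∖ {a}. These private leaves are pairwise distinct, so |A| ≤ ℓ(T).

module Submission where

open import Data.Bool using (Bool; true; false; not; _∧_)
open import Data.Bool.Properties as Bool using (∧-conicalˡ; ∧-conicalʳ; ∧-zeroʳ; T-≡)
open import Data.Empty using (⊥; ⊥-elim)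
open import Data.Fin using (Fin; zero; suc; toℕ)
open import Data.Fin.Properties using (_≟_; any?; injective⇒≤; toℕ-injective)
open import Data.Fin.Subset
  using (Subset; inside; outside; _∈_; _⊆_; _⊂_; _∩_; _∪_; _-_; ⁅_⁆; ⊤; ∣_∣; Nonempty)
  renaming (⊥ to ∅)
open import Data.Fin.Subset.Properties
  using (_∈?_; nonempty?; Empty-unique; ∣⊥∣≡0; ∣⊤∣≡n; ∣⁅x⁆∣≡1; ⊆-refl; ⊆-antisym; ⊆-min; s⊆s; out⊆;
         drop-∷-⊆; p⊆q⇒∣p∣≤∣q∣; p⊂q⇒∣p∣<∣q∣; x∈p⇒∣p-x∣<∣p∣; x∈p⇒p-x⊂p; x∈p∧x≢y⇒x∈p-y;
         p─⊥≡p; x∈p∩q⁺; x∈p∩q⁻; x∈p∪q⁺; x∈p∪q⁻; x∈⁅y⁆⇒x≡y; x∈⁅x⁆; ∈⊤)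
open import Data.Fin.Subset.Induction using (⊂-wellFounded)
open import Data.List using (List; []; _∷_; _++_; [_]; length; map; allFin; tabulate)
import Data.List as List
open import Data.List.Properties using (map-tabulate; map-cong)
open import Data.List.Membership.Propositional using () renaming (_∈_ to _∈ˡ_)
open import Data.List.Membership.Propositional.Properties using (∈-allFin; ∈-lookup)
open import Data.List.Relation.Unary.All as All using (All; []; _∷_)
open import Data.List.Relation.Unary.All.Properties using (anti-mono; ¬Any⇒All¬)
open import Data.List.Relation.Unary.AllPairs using ([]; _∷_)
open import Data.List.Relation.Unary.Any using (here; there)
open import Data.List.Relation.Unary.Linked using (Linked; [-]; _∷_)
open import Data.List.Relation.Unary.Unique.Propositional using (Unique)
open import Data.Nat using (ℕ; zero; suc; _+_; _⊔_; _≤_; _<_; _<ᵇ_; _≡ᵇ_; z≤n; s≤s; _≤?_; _<?_)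
open import Data.Nat.ListAction using (sum)
open import Data.Nat.Properties hiding (_≟_; <-cmp)
import Data.Nat.Properties as ℕ
open import Data.Product using (Σ; ∃; ∃-syntax; _×_; _,_; proj₁; proj₂)
open import Data.Sum using (_⊎_; inj₁; inj₂)
open import Data.Vec using (_∷_; []; here; there) renaming (tabulate to tabulateᵛ)
open import Data.Vec.Properties using (lookup∘tabulate; []=⇒lookup; lookup⇒[]=)
open import Function using (_∘_; Equivalence)
open import Induction.WellFounded using (Acc; acc)
open import Relation.Binary.Construct.Closure.ReflexiveTransitive
  using (Star; ε; _◅_; _◅◅_; revApp; reverse)
import Relation.Binary.Construct.Closure.ReflexiveTransitive as Star
open import Relation.Binary.Definitions using (DecidableEquality; tri<; tri≈; tri>)
open import Relation.Binary.PropositionalEquality hiding ([_])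
open import Relation.Nullary using (¬_; Dec; yes; no; does; ¬?; contradiction)
open import Relation.Nullary.Decidable
  using (dec-true; dec-false; decidable-stable; ¬¬-excluded-middle; _×-dec_)
open import Relation.Nullary.Negation using (¬¬-map)
open import Relation.Unary using (Decidable)

open import Defs hiding (sym)

-- Counting subsets

∈-tabulate⁺ : ∀ {n} {f : Fin n → Bool} {x} → f x ≡ true → x ∈ tabulateᵛ f
∈-tabulate⁺ {f = f} {x} fx = lookup⇒[]= x (tabulateᵛ f) (trans (lookup∘tabulate f x) fx)

∈-tabulate⁻ : ∀ {n} {f : Fin n → Bool} {x} → x ∈ tabulateᵛ f → f x ≡ true
∈-tabulate⁻ {f = f} {x} x∈ = trans (sym (lookup∘tabulate f x)) ([]=⇒lookup x∈)

∣b∷p∣ : ∀ {n} b (p : Subset n) → ∣ b ∷ p ∣ ≡ b2n b + ∣ p ∣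
∣b∷p∣ true  p = refl
∣b∷p∣ false p = refl

sum-b2n≡∣tabulate∣ : ∀ {n} (f : Fin n → Bool) → sum (map (b2n ∘ f) (allFin n)) ≡ ∣ tabulateᵛ f ∣
sum-b2n≡∣tabulate∣ {zero}  f = refl
sum-b2n≡∣tabulate∣ {suc n} f = begin
  b2n (f zero) + sum (map (b2n ∘ f) (tabulate suc))
    ≡⟨ cong (λ xs → b2n (f zero) + sum xs) (map-tabulate suc (b2n ∘ f)) ⟩
  b2n (f zero) + sum (tabulate (b2n ∘ f ∘ suc))
    ≡⟨ cong (λ xs → b2n (f zero) + sum xs) (sym (map-tabulate (λ i → i) (b2n ∘ f ∘ suc))) ⟩
  b2n (f zero) + sum (map (b2n ∘ f ∘ suc) (allFin n))
    ≡⟨ cong (b2n (f zero) +_) (sum-b2n≡∣tabulate∣ (f ∘ suc)) ⟩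
  b2n (f zero) + ∣ tabulateᵛ (f ∘ suc) ∣
    ≡⟨ sym (∣b∷p∣ (f zero) (tabulateᵛ (f ∘ suc))) ⟩
  ∣ tabulateᵛ f ∣ ∎
  where open ≡-Reasoning

sum-map-mono-≤ : ∀ {A : Set} {f g : A → ℕ} → (∀ x → f x ≤ g x) → ∀ xs → sum (map f xs) ≤ sum (map g xs)
sum-map-mono-≤ f≤g []       = z≤n
sum-map-mono-≤ f≤g (x ∷ xs) = +-mono-≤ (f≤g x) (sum-map-mono-≤ f≤g xs)

sum-map-mono-< : ∀ {A : Set} {f g : A → ℕ} {x xs} → (∀ y → f y ≤ g y) → x ∈ˡ xs → f x < g x →
                 sum (map f xs) < sum (map g xs)
sum-map-mono-< f≤g (here {xs = xs} refl) fx<gx = +-mono-<-≤ fx<gx (sum-map-mono-≤ f≤g xs)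
sum-map-mono-< f≤g (there {y} x∈xs) fx<gx = +-mono-≤-< (f≤g y) (sum-map-mono-< f≤g x∈xs fx<gx)

pairCount : ∀ {n} → (Fin n → Fin n → Bool) → ℕ
pairCount {n} f = sum (map (λ i → sum (map (λ j → b2n (f i j)) (allFin n))) (allFin n))

pairCount-< : ∀ {n} {f g : Fin n → Fin n → Bool} {i j} → (∀ i j → f i j ≡ true → g i j ≡ true) →
              g i j ≡ true → f i j ≡ false → pairCount f < pairCount g
pairCount-< {n} {f} {g} {i} {j} f⇒g gij fij = begin-strict
  pairCount f                                      ≡⟨ rows f ⟩
  sum (map (λ r → ∣ tabulateᵛ (f r) ∣) (allFin n)) <⟨ sum-map-mono-< ∣row∣≤ (∈-allFin i) ∣row-i∣< ⟩
  sum (map (λ r → ∣ tabulateᵛ (g r) ∣) (allFin n)) ≡⟨ rows g ⟨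
  pairCount g                                      ∎
  where
  open ≤-Reasoning
  rows : ∀ h → pairCount h ≡ sum (map (λ r → ∣ tabulateᵛ (h r) ∣) (allFin n))
  rows h = cong sum (map-cong (λ r → sum-b2n≡∣tabulate∣ (h r)) (allFin n))
  row⊆ : ∀ r → tabulateᵛ (f r) ⊆ tabulateᵛ (g r)
  row⊆ r x∈ = ∈-tabulate⁺ {f = g r} (f⇒g r _ (∈-tabulate⁻ {f = f r} x∈))
  ∣row∣≤ : ∀ r → ∣ tabulateᵛ (f r) ∣ ≤ ∣ tabulateᵛ (g r) ∣
  ∣row∣≤ r = p⊆q⇒∣p∣≤∣q∣ (row⊆ r)
  ∣row-i∣< : ∣ tabulateᵛ (f i) ∣ < ∣ tabulateᵛ (g i) ∣
  ∣row-i∣< = p⊂q⇒∣p∣<∣q∣ (row⊆ i , j , ∈-tabulate⁺ {f = g i} gij ,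
                          λ j∈ → contradiction (trans (sym fij) (∈-tabulate⁻ {f = f i} j∈)) λ ())

∧-monoʳ-true : ∀ {e e′ : Bool} → (e ≡ true → e′ ≡ true) → ∀ c → c ∧ e ≡ true → c ∧ e′ ≡ true
∧-monoʳ-true e⇒e′ true = e⇒e′

_≢ᵇ_ : ∀ {n} → Fin n → Fin n → Bool
i ≢ᵇ v = not (does (i ≟ v))

≢⇒≢ᵇ : ∀ {n} {i v : Fin n} → i ≢ v → i ≢ᵇ v ≡ true
≢⇒≢ᵇ {i = i} {v} i≢v = cong not (dec-false (i ≟ v) i≢v)

≢ᵇ⇒≢ : ∀ {n} {i v : Fin n} → i ≢ᵇ v ≡ true → i ≢ v
≢ᵇ⇒≢ {i = i} i≢ᵇi refl with () ← trans (sym (cong not (dec-true (i ≟ i) refl))) i≢ᵇi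

∣p∣≡1+∣p-x∣ : ∀ {n} {p : Subset n} {x} → x ∈ p → ∣ p ∣ ≡ suc ∣ p - x ∣
∣p∣≡1+∣p-x∣ {p = inside ∷ p}  {zero}  _            = cong (suc ∘ ∣_∣) (sym (p─⊥≡p p))
∣p∣≡1+∣p-x∣ {p = inside ∷ p}  {suc x} (there x∈p) = cong suc (∣p∣≡1+∣p-x∣ x∈p)
∣p∣≡1+∣p-x∣ {p = outside ∷ p} {suc x} (there x∈p) = ∣p∣≡1+∣p-x∣ x∈p

x∈p-y⁻ : ∀ {n} {p : Subset n} {x y} → x ∈ p - y → x ∈ p × x ≢ y
x∈p-y⁻ {p = _ ∷ p} {zero}  {suc y} here        = here , λ ()
x∈p-y⁻ {p = _ ∷ p} {suc x} {zero}  (there x∈) = there (subst (_ ∈_) (p─⊥≡p p) x∈) , λ ()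
x∈p-y⁻ {p = _ ∷ p} {suc x} {suc y} (there x∈) with x∈p-y⁻ x∈
... | x∈p , x≢y = there x∈p , λ { refl → x≢y refl }

∣p∪q∣≤∣p∣+∣q∣ : ∀ {n} (p q : Subset n) → ∣ p ∪ q ∣ ≤ ∣ p ∣ + ∣ q ∣
∣p∪q∣≤∣p∣+∣q∣ []            []            = z≤n
∣p∪q∣≤∣p∣+∣q∣ (outside ∷ p) (outside ∷ q) = ∣p∪q∣≤∣p∣+∣q∣ p q
∣p∪q∣≤∣p∣+∣q∣ (outside ∷ p) (inside ∷ q)  =
  subst (suc ∣ p ∪ q ∣ ≤_) (sym (+-suc ∣ p ∣ ∣ q ∣)) (s≤s (∣p∪q∣≤∣p∣+∣q∣ p q))
∣p∪q∣≤∣p∣+∣q∣ (inside ∷ p)  (outside ∷ q) = s≤s (∣p∪q∣≤∣p∣+∣q∣ p q)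
∣p∪q∣≤∣p∣+∣q∣ (inside ∷ p)  (inside ∷ q)  =
  s≤s (≤-trans (∣p∪q∣≤∣p∣+∣q∣ p q) (+-monoʳ-≤ ∣ p ∣ (n≤1+n ∣ q ∣)))

⁅x⁆∪⁅y⁆⊆p : ∀ {n} {p : Subset n} {x y} → x ∈ p → y ∈ p → ⁅ x ⁆ ∪ ⁅ y ⁆ ⊆ p
⁅x⁆∪⁅y⁆⊆p {x = x} {y} x∈p y∈p z∈ with x∈p∪q⁻ ⁅ x ⁆ ⁅ y ⁆ z∈
... | inj₁ z∈⁅x⁆ = subst (_∈ _) (sym (x∈⁅y⁆⇒x≡y x z∈⁅x⁆)) x∈p
... | inj₂ z∈⁅y⁆ = subst (_∈ _) (sym (x∈⁅y⁆⇒x≡y y z∈⁅y⁆)) y∈p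

∣⁅x⁆∪⁅y⁆∣≤2 : ∀ {n} (x y : Fin n) → ∣ ⁅ x ⁆ ∪ ⁅ y ⁆ ∣ ≤ 2
∣⁅x⁆∪⁅y⁆∣≤2 x y =
  subst₂ (λ a b → ∣ ⁅ x ⁆ ∪ ⁅ y ⁆ ∣ ≤ a + b) (∣⁅x⁆∣≡1 x) (∣⁅x⁆∣≡1 y) (∣p∪q∣≤∣p∣+∣q∣ ⁅ x ⁆ ⁅ y ⁆)

Empty⇒∣p∣≡0 : ∀ {n} {p : Subset n} → ¬ Nonempty p → ∣ p ∣ ≡ 0
Empty⇒∣p∣≡0 {n} empty = trans (cong ∣_∣ (Empty-unique empty)) (∣⊥∣≡0 n)

1≤∣p∣⇒Nonempty : ∀ {n} {p : Subset n} → 1 ≤ ∣ p ∣ → Nonempty p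
1≤∣p∣⇒Nonempty {p = p} 1≤∣p∣ with nonempty? p
... | yes ne    = ne
... | no  empty = contradiction (Empty⇒∣p∣≡0 empty) (≢-sym (<⇒≢ 1≤∣p∣))

⊆∧∣∣≤⇒⊇ : ∀ {n} {p q : Subset n} → p ⊆ q → ∣ q ∣ ≤ ∣ p ∣ → q ⊆ p
⊆∧∣∣≤⇒⊇ {p = p} {q} p⊆q ∣q∣≤∣p∣ {x} x∈q with x ∈? p
... | yes x∈p = x∈p
... | no  x∉p = ⊥-elim (<-irrefl refl (begin-strict
  ∣ p ∣     ≤⟨ p⊆q⇒∣p∣≤∣q∣ (λ y∈p → x∈p∧x≢y⇒x∈p-y {y = x} (p⊆q y∈p) λ { refl → x∉p y∈p }) ⟩
  ∣ q - x ∣ <⟨ x∈p⇒∣p-x∣<∣p∣ x∈q ⟩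
  ∣ q ∣     ≤⟨ ∣q∣≤∣p∣ ⟩
  ∣ p ∣     ∎))
  where open ≤-Reasoning

between : ∀ {n} {d c : Subset n} {k} → d ⊆ c → ∣ d ∣ ≤ k → k ≤ ∣ c ∣ →
          ∃[ b ] d ⊆ b × b ⊆ c × ∣ b ∣ ≡ k
between {d = []} {[]} _ _ z≤n = [] , (λ ()) , (λ ()) , refl
between {d = inside ∷ d} {outside ∷ c} d⊆c _ _ with d⊆c here
... | ()
between {d = inside ∷ d} {inside ∷ c} {suc k} d⊆c (s≤s ∣d∣≤k) (s≤s k≤∣c∣)
  with b , d⊆b , b⊆c , ∣b∣≡k ← between (drop-∷-⊆ d⊆c) ∣d∣≤k k≤∣c∣
  = inside ∷ b , s⊆s d⊆b , s⊆s b⊆c , cong suc ∣b∣≡k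
between {d = outside ∷ d} {outside ∷ c} d⊆c ∣d∣≤k k≤∣c∣
  with b , d⊆b , b⊆c , ∣b∣≡k ← between (drop-∷-⊆ d⊆c) ∣d∣≤k k≤∣c∣
  = outside ∷ b , s⊆s d⊆b , s⊆s b⊆c , ∣b∣≡k
between {d = outside ∷ d} {inside ∷ c} {k} d⊆c ∣d∣≤k k≤1+∣c∣ with k ≤? ∣ c ∣
... | yes k≤∣c∣ with b , d⊆b , b⊆c , ∣b∣≡k ← between (drop-∷-⊆ d⊆c) ∣d∣≤k k≤∣c∣
  = outside ∷ b , s⊆s d⊆b , out⊆ b⊆c , ∣b∣≡k
... | no  k≰∣c∣ = inside ∷ c , d⊆c , ⊆-refl , ≤-antisym (≰⇒> k≰∣c∣) k≤1+∣c∣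

card-≤-injection : ∀ {n} {p q : Subset n} → Acc _⊂_ p →
                   (f : ∀ x → x ∈ p → Fin n) → (∀ x x∈p → f x x∈p ∈ q) →
                   (∀ x y x∈p y∈p → f x x∈p ≡ f y y∈p → x ≡ y) → ∣ p ∣ ≤ ∣ q ∣
card-≤-injection {p = p} {q} (acc smaller) f f∈q f-inj with nonempty? p
... | no  empty = subst (_≤ ∣ q ∣) (sym (Empty⇒∣p∣≡0 empty)) z≤n
... | yes (x , x∈p) = begin
  ∣ p ∣                ≡⟨ ∣p∣≡1+∣p-x∣ x∈p ⟩
  suc ∣ p - x ∣         ≤⟨ s≤s (card-≤-injection (smaller (x∈p⇒p-x⊂p x∈p)) f′ f′∈q-fx f′-inj) ⟩
  suc ∣ q - f x x∈p ∣   ≡⟨ ∣p∣≡1+∣p-x∣ (f∈q x x∈p) ⟨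
  ∣ q ∣                ∎
  where
  open ≤-Reasoning
  f′ : ∀ y → y ∈ p - x → Fin _
  f′ y y∈ = f y (proj₁ (x∈p-y⁻ y∈))
  f′∈q-fx : ∀ y y∈ → f′ y y∈ ∈ q - f x x∈p
  f′∈q-fx y y∈ = x∈p∧x≢y⇒x∈p-y (f∈q y _) (proj₂ (x∈p-y⁻ y∈) ∘ f-inj y x _ x∈p)
  f′-inj : ∀ y z y∈ z∈ → f′ y y∈ ≡ f′ z z∈ → y ≡ z
  f′-inj y z _ _ = f-inj y z _ _

subset-ofSize : ∀ {n k} → k ≤ n → ∃[ b ] ∣ b ∣ ≡ k
subset-ofSize {n} {k} k≤n
  with b , _ , _ , ∣b∣≡k ← between {d = ∅ {n}} {⊤} (⊆-min ⊤) (subst (_≤ k) (sym (∣⊥∣≡0 n)) z≤n)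
                                  (subst (k ≤_) (sym (∣⊤∣≡n n)) k≤n)
  = b , ∣b∣≡k

lookup-injective : ∀ {A : Set} {xs : List A} → Unique xs →
                   ∀ {i j} → List.lookup xs i ≡ List.lookup xs j → i ≡ j
lookup-injective (_ ∷ _)        {zero}  {zero}  _  = refl
lookup-injective (x∉ ∷ _)       {zero}  {suc j} eq = ⊥-elim (All.lookup x∉ (∈-lookup j) eq)
lookup-injective (x∉ ∷ _)       {suc i} {zero}  eq = ⊥-elim (All.lookup x∉ (∈-lookup i) (sym eq))
lookup-injective (_ ∷ unique)   {suc i} {suc j} eq = cong suc (lookup-injective unique eq)

Unique⇒length≤ : ∀ {n} {xs : List (Fin n)} → Unique xs → length xs ≤ n
Unique⇒length≤ unique = injective⇒≤ (lookup-injective unique)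

¬¬-choice : ∀ {n} {P Q : Fin n → Set} → Decidable P → (∀ i → P i → ¬ ¬ Q i) → ¬ ¬ (∀ i → P i → Q i)
¬¬-choice {zero}  P? f k = k (λ ())
¬¬-choice {suc n} {P} {Q} P? f k =
  choice₀ λ q₀ → ¬¬-choice (P? ∘ suc) (f ∘ suc) λ qs → k λ { zero → q₀ ; (suc i) → qs i }
  where
  choice₀ : ¬ ¬ (P zero → Q zero)
  choice₀ with P? zero
  ... | yes p₀ = ¬¬-map (λ q₀ _ → q₀) (f zero p₀)
  ... | no ¬p₀ = λ k₀ → k₀ (⊥-elim ∘ ¬p₀)

-- Walks and paths

module _ {V : Set} {R : V → V → Set} where

  -- Mutual, so that vertices p reduces to x ∷ _ whatever p is.
  mutual
    vertices : ∀ {x y} → Star R x y → List V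
    vertices {x} p = x ∷ successors p

    successors : ∀ {x y} → Star R x y → List V
    successors ε       = []
    successors (_ ◅ p) = vertices p

  infix 4 _∈ʷ_ _∉ʷ_

  _∈ʷ_ : ∀ {x y} → V → Star R x y → Set
  v ∈ʷ p = v ∈ˡ vertices p

  _∉ʷ_ : ∀ {x y} → V → Star R x y → Set
  v ∉ʷ p = ¬ v ∈ʷ p

  end∈ʷ : ∀ {x y} (p : Star R x y) → y ∈ʷ p
  end∈ʷ ε       = here refl
  end∈ʷ (_ ◅ p) = there (end∈ʷ p)

  ∈ʷ-◅◅⁻ : ∀ {x y z v} (p : Star R x y) (q : Star R y z) → v ∈ʷ p ◅◅ q → v ∈ʷ p ⊎ v ∈ʷ q
  ∈ʷ-◅◅⁻ ε       q v∈           = inj₂ v∈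
  ∈ʷ-◅◅⁻ (_ ◅ p) q (here refl) = inj₁ (here refl)
  ∈ʷ-◅◅⁻ (_ ◅ p) q (there v∈) with ∈ʷ-◅◅⁻ p q v∈
  ... | inj₁ v∈p = inj₁ (there v∈p)
  ... | inj₂ v∈q = inj₂ v∈q

  ∉ʷ-◅◅ : ∀ {x y z v} {p : Star R x y} {q : Star R y z} → v ∉ʷ p → v ∉ʷ q → v ∉ʷ p ◅◅ q
  ∉ʷ-◅◅ {p = p} {q} v∉p v∉q v∈ with ∈ʷ-◅◅⁻ p q v∈
  ... | inj₁ v∈p = v∉p v∈p
  ... | inj₂ v∈q = v∉q v∈q

  module _ (R-sym : ∀ {a b} → R a b → R b a) where

    ∈ʷ-revApp⁻ : ∀ {x y z v} (p : Star R y x) (q : Star R y z) → v ∈ʷ revApp R-sym p q → v ∈ʷ p ⊎ v ∈ʷ q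
    ∈ʷ-revApp⁻ ε       q v∈ = inj₂ v∈
    ∈ʷ-revApp⁻ (e ◅ p) q v∈ with ∈ʷ-revApp⁻ p (R-sym e ◅ q) v∈
    ... | inj₁ v∈p         = inj₁ (there v∈p)
    ... | inj₂ (here refl) = inj₁ (there (here refl))
    ... | inj₂ (there v∈q) = inj₂ v∈q

    ∉ʷ-reverse : ∀ {x y v} {p : Star R x y} → v ∉ʷ p → v ∉ʷ reverse R-sym p
    ∉ʷ-reverse {p = p} v∉p v∈ with ∈ʷ-revApp⁻ p ε v∈
    ... | inj₁ v∈p         = v∉p v∈p
    ... | inj₂ (here refl) = v∉p (here refl)

  linked-vertices : ∀ {x y z} (p : Star R x y) → R y z → Linked R (vertices p ++ [ z ])
  linked-vertices ε       r = r ∷ [-]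
  linked-vertices (e ◅ p) r = e ∷ linked-vertices p r

  dropUntil : ∀ {x y v} (p : Star R x y) → v ∈ʷ p → Star R v y
  dropUntil p       (here refl) = p
  dropUntil (_ ◅ p) (there v∈)  = dropUntil p v∈

  dropUntil-⊆ : ∀ {x y v u} (p : Star R x y) (v∈ : v ∈ʷ p) → u ∈ʷ dropUntil p v∈ → u ∈ʷ p
  dropUntil-⊆ p       (here refl) u∈ = u∈
  dropUntil-⊆ (_ ◅ p) (there v∈)  u∈ = there (dropUntil-⊆ p v∈ u∈)

  dropUntil-unique : ∀ {x y v} (p : Star R x y) (v∈ : v ∈ʷ p) →
                     Unique (vertices p) → Unique (vertices (dropUntil p v∈))
  dropUntil-unique p       (here refl) u       = u
  dropUntil-unique (_ ◅ p) (there v∈)  (_ ∷ u) = dropUntil-unique p v∈ u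

  takeUntil : ∀ {x y v} (p : Star R x y) → v ∈ʷ p → Star R x v
  takeUntil p       (here refl) = ε
  takeUntil (e ◅ p) (there v∈)  = e ◅ takeUntil p v∈

  takeUntil-⊆ : ∀ {x y v u} (p : Star R x y) (v∈ : v ∈ʷ p) → u ∈ʷ takeUntil p v∈ → u ∈ʷ p
  takeUntil-⊆ p       (here refl) (here refl) = here refl
  takeUntil-⊆ (_ ◅ p) (there v∈)  (here refl) = here refl
  takeUntil-⊆ (_ ◅ p) (there v∈)  (there u∈)  = there (takeUntil-⊆ p v∈ u∈)

  takeUntil-unique : ∀ {x y v} (p : Star R x y) (v∈ : v ∈ʷ p) →
                     Unique (vertices p) → Unique (vertices (takeUntil p v∈))
  takeUntil-unique p       (here refl) _         = [] ∷ []
  takeUntil-unique (_ ◅ p) (there v∈)  (x∉ ∷ u) = anti-mono (takeUntil-⊆ p v∈) x∉ ∷ takeUntil-unique p v∈ u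

  end∉ʷ-init : ∀ {x y z} (p : Star R x y) (e : R y z) → Unique (vertices (p ◅◅ e ◅ ε)) → z ∉ʷ p
  end∉ʷ-init ε        e ((y≢z ∷ []) ∷ _) (here refl) = y≢z refl
  end∉ʷ-init (e′ ◅ p) e (x∉ ∷ _)          (here refl) = All.lookup x∉ (end∈ʷ (p ◅◅ e ◅ ε)) refl
  end∉ʷ-init (e′ ◅ p) e (_ ∷ u)           (there z∈)  = end∉ʷ-init p e u z∈

module Paths {V : Set} (_≟ᵥ_ : DecidableEquality V) {R : V → V → Set} where

  open import Data.List.Membership.DecPropositional _≟ᵥ_ using () renaming (_∈?_ to _∈ˡ?_)

  _∈ʷ?_ : ∀ {x y} v (p : Star R x y) → Dec (v ∈ʷ p)
  v ∈ʷ? p = v ∈ˡ? vertices p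

  toPath : ∀ {x y} → Star R x y → Star R x y
  toPath ε = ε
  toPath {x} (e ◅ p) with x ∈ʷ? toPath p
  ... | yes x∈ = dropUntil (toPath p) x∈
  ... | no  _  = e ◅ toPath p

  toPath-⊆ : ∀ {x y v} (p : Star R x y) → v ∈ʷ toPath p → v ∈ʷ p
  toPath-⊆ ε v∈ = v∈
  toPath-⊆ {x} (e ◅ p) v∈ with x ∈ʷ? toPath p
  ... | yes x∈ = there (toPath-⊆ p (dropUntil-⊆ (toPath p) x∈ v∈))
  toPath-⊆ {x} (e ◅ p) (here refl) | no _ = here refl
  toPath-⊆ {x} (e ◅ p) (there v∈) | no _ = there (toPath-⊆ p v∈)

  toPath-unique : ∀ {x y} (p : Star R x y) → Unique (vertices (toPath p))
  toPath-unique ε = [] ∷ []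
  toPath-unique {x} (e ◅ p) with x ∈ʷ? toPath p
  ... | yes x∈ = dropUntil-unique (toPath p) x∈ (toPath-unique p)
  ... | no  x∉ = ¬Any⇒All¬ (vertices (toPath p)) x∉ ∷ toPath-unique p

  interior-neighbours : ∀ {x y v} (p : Star R x y) → Unique (vertices p) → v ∈ʷ p → v ≢ x → v ≢ y →
                        ∃[ a ] ∃[ b ] R a v × R v b × a ≢ b
  interior-neighbours p _ (here refl) v≢x _ = ⊥-elim (v≢x refl)
  interior-neighbours {v = v} (_◅_ {j = x₁} e p) (x∉ ∷ u) (there v∈) v≢x v≢y with v ≟ᵥ x₁
  interior-neighbours (e ◅ ε)        _        (there v∈) v≢x v≢y | yes refl = ⊥-elim (v≢y refl)
  interior-neighbours (e ◅ (e′ ◅ p)) (x∉ ∷ _) (there v∈) v≢x v≢y | yes refl =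
    _ , _ , e , e′ , All.lookup x∉ (there (here refl))
  ... | no v≢x₁ = interior-neighbours p u v∈ v≢x₁ v≢y

  avoidOneOf : ∀ {x a a′} → a ≢ a′ → Star R x a′ → Σ (Star R x a′) (a ∉ʷ_) ⊎ Σ (Star R x a) (a′ ∉ʷ_)
  avoidOneOf a≢a′ ε = inj₁ (ε , λ { (here refl) → a≢a′ refl })
  avoidOneOf {x} {a} {a′} a≢a′ (e ◅ p) with x ≟ᵥ a | x ≟ᵥ a′
  ... | yes refl | _        = inj₂ (ε , λ { (here refl) → a≢a′ refl })
  ... | no  _    | yes refl = inj₁ (ε , λ { (here refl) → a≢a′ refl })
  ... | no  x≢a  | no  x≢a′ with avoidOneOf a≢a′ p
  ...   | inj₁ (q , a∉q)   = inj₁ (e ◅ q , λ { (here refl) → x≢a refl ; (there a∈) → a∉q a∈ })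
  ...   | inj₂ (q , a′∉q) = inj₂ (e ◅ q , λ { (here refl) → x≢a′ refl ; (there a′∈) → a′∉q a′∈ })

open module FinPaths {n : ℕ} = Paths (_≟_ {n})

vertices-map : ∀ {V : Set} {R R′ : V → V → Set} (f : ∀ {a b} → R a b → R′ a b) {x y} (p : Star R x y) →
               vertices (Star.map f p) ≡ vertices p
vertices-map f ε       = refl
vertices-map f {x} (e ◅ p) = cong (x ∷_) (vertices-map f p)

restrictWalk : ∀ {V : Set} {R R′ : V → V → Set} {P : V → Set} → (∀ {a b} → R a b → P a → P b → R′ a b) →
               ∀ {x y} (p : Star R x y) → All P (vertices p) → Star R′ x y
restrictWalk f ε       _          = ε
restrictWalk f (e ◅ p) (Pa ∷ Ps) = f e Pa (All.head Ps) ◅ restrictWalk f p Ps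

-- Degrees, leaves and separation

module _ {n} (G : Graph n) where

  Adj-sym : ∀ {i j} → Adj G i j → Adj G j i
  Adj-sym {i} {j} ij = trans (Graph.sym G j i) ij

  Adj-irrefl : ∀ {i} → ¬ Adj G i i
  Adj-irrefl {i} ii with trans (sym ii) (irrefl G i)
  ... | ()

  Adj? : ∀ i j → Dec (Adj G i j)
  Adj? i j = adj G i j Bool.≟ true

  neighbours : Fin n → Subset n
  neighbours v = tabulateᵛ (adj G v)

  degree≡∣neighbours∣ : ∀ v → degree G v ≡ ∣ neighbours v ∣
  degree≡∣neighbours∣ v = sum-b2n≡∣tabulate∣ (adj G v)

  IsLeaf : Fin n → Set
  IsLeaf v = degree G v ≡ 1

  leafSet : Subset n
  leafSet = tabulateᵛ (λ v → degree G v ≡ᵇ 1)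

  leaves≡∣leafSet∣ : leaves G ≡ ∣ leafSet ∣
  leaves≡∣leafSet∣ = sum-b2n≡∣tabulate∣ (λ v → degree G v ≡ᵇ 1)

  ∈-leafSet⁺ : ∀ {v} → IsLeaf v → v ∈ leafSet
  ∈-leafSet⁺ {v} leaf =
    ∈-tabulate⁺ {f = λ v → degree G v ≡ᵇ 1} (Equivalence.to T-≡ (≡⇒≡ᵇ (degree G v) 1 leaf))

  ∈-leafSet⁻ : ∀ {v} → v ∈ leafSet → IsLeaf v
  ∈-leafSet⁻ {v} v∈ = ≡ᵇ⇒≡ (degree G v) 1 (Equivalence.from T-≡ (∈-tabulate⁻ v∈))

  2≤degree : ∀ {v a b} → Adj G v a → Adj G v b → a ≢ b → 2 ≤ degree G v
  2≤degree {v} {a} {b} va vb a≢b = subst (2 ≤_) (sym degree≡) (s≤s (s≤s z≤n))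
    where
    open ≡-Reasoning
    b∈N-a : b ∈ neighbours v - a
    b∈N-a = x∈p∧x≢y⇒x∈p-y (∈-tabulate⁺ {f = adj G v} vb) (≢-sym a≢b)
    degree≡ : degree G v ≡ suc (suc ∣ neighbours v - a - b ∣)
    degree≡ = begin
      degree G v                          ≡⟨ degree≡∣neighbours∣ v ⟩
      ∣ neighbours v ∣                     ≡⟨ ∣p∣≡1+∣p-x∣ (∈-tabulate⁺ {f = adj G v} va) ⟩
      suc ∣ neighbours v - a ∣             ≡⟨ cong suc (∣p∣≡1+∣p-x∣ b∈N-a) ⟩
      suc (suc ∣ neighbours v - a - b ∣)   ∎

  leaf-neighbour-unique : ∀ {v a b} → IsLeaf v → Adj G v a → Adj G v b → a ≡ b
  leaf-neighbour-unique {a = a} {b} leaf va vb with a ≟ b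
  ... | yes a≡b = a≡b
  ... | no  a≢b = ⊥-elim (<-irrefl refl (subst (2 ≤_) leaf (2≤degree va vb a≢b)))

  neighbour-unique⇒IsLeaf : ∀ {v p} → Adj G v p → (∀ w → Adj G v w → w ≡ p) → IsLeaf v
  neighbour-unique⇒IsLeaf {v} {p} vp unique = begin
    degree G v       ≡⟨ degree≡∣neighbours∣ v ⟩
    ∣ neighbours v ∣ ≡⟨ cong ∣_∣ (⊆-antisym N⊆⁅p⁆ ⁅p⁆⊆N) ⟩
    ∣ ⁅ p ⁆ ∣        ≡⟨ ∣⁅x⁆∣≡1 p ⟩
    1                ∎
    where
    open ≡-Reasoning
    N⊆⁅p⁆ : neighbours v ⊆ ⁅ p ⁆
    N⊆⁅p⁆ {w} w∈ = subst (_∈ ⁅ p ⁆) (sym (unique w (∈-tabulate⁻ w∈))) (x∈⁅x⁆ p)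
    ⁅p⁆⊆N : ⁅ p ⁆ ⊆ neighbours v
    ⁅p⁆⊆N {w} w∈ = subst (_∈ neighbours v) (sym (x∈⁅y⁆⇒x≡y p w∈)) (∈-tabulate⁺ {f = adj G v} vp)

  Separates : Fin n → Fin n → Fin n → Set
  Separates a u w = ∀ (p : Star (Adj G) u w) → a ∈ʷ p

  separates-transfer : ∀ {a y b c} → Separates a y b → (p : Star (Adj G) y c) → a ∉ʷ p → Separates a c b
  separates-transfer {a} sep p a∉p r = decidable-stable (a ∈ʷ? r) λ a∉r → ∉ʷ-◅◅ a∉p a∉r (sep (p ◅◅ r))

-- Paths in acyclic graphs

module _ {n} {G : Graph n} (acyclic : ¬ HasCycle G) where

  noCycle : ∀ {x x₁ y} (e : Adj G x x₁) (p : Star (Adj G) x₁ y) → Unique (vertices (e ◅ p)) → x₁ ≢ y →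
            ¬ Adj G y x
  noCycle {x} e p unique x₁≢y yx =
    acyclic (x , vertices p , 2≤length p x₁≢y , unique , e ∷ linked-vertices p yx)
    where
    2≤length : ∀ {u w} (q : Star (Adj G) u w) → u ≢ w → 2 ≤ length (vertices q)
    2≤length ε       u≢w = ⊥-elim (u≢w refl)
    2≤length (_ ◅ _) _   = s≤s (s≤s z≤n)

  adjacent-on-path≡successor : ∀ {x x₁ y w} (e : Adj G x x₁) (p : Star (Adj G) x₁ y) →
                               Unique (vertices (e ◅ p)) → Adj G x w → w ∈ʷ p → w ≡ x₁
  adjacent-on-path≡successor {x₁ = x₁} {w = w} e p (x∉p ∷ unique) xw w∈p with w ≟ x₁
  ... | yes w≡x₁ = w≡x₁
  ... | no  w≢x₁ = ⊥-elim (noCycle e (takeUntil p w∈p)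
                     (anti-mono (takeUntil-⊆ p w∈p) x∉p ∷ takeUntil-unique p w∈p unique)
                     (≢-sym w≢x₁) (Adj-sym G xw))

  no-bypass : ∀ {a y₁ y₂} → Adj G a y₁ → Adj G a y₂ → y₁ ≢ y₂ → (p : Star (Adj G) y₁ y₂) → a ∉ʷ p → ⊥
  no-bypass ay₁ ay₂ y₁≢y₂ p a∉p = y₁≢y₂ (sym (adjacent-on-path≡successor ay₁ (toPath p)
    (¬Any⇒All¬ _ (a∉p ∘ toPath-⊆ p) ∷ toPath-unique p) ay₂ (end∈ʷ (toPath p))))

  sibling-separates : ∀ {a y₁ y₂ b} → Adj G a y₁ → Adj G a y₂ → y₁ ≢ y₂ →
                      (p : Star (Adj G) y₂ b) → a ∉ʷ p → Separates G a y₁ b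
  sibling-separates {a} ay₁ ay₂ y₁≢y₂ p a∉p q = decidable-stable (a ∈ʷ? q) λ a∉q →
    no-bypass ay₁ ay₂ y₁≢y₂ (q ◅◅ reverse (Adj-sym G) p) (∉ʷ-◅◅ a∉q (∉ʷ-reverse (Adj-sym G) a∉p))

  path-start-leaf : ∀ {x x₁ y} (e : Adj G x x₁) (p : Star (Adj G) x₁ y) → Unique (vertices (e ◅ p)) →
                    (∀ w → Adj G x w → w ∈ʷ e ◅ p) → IsLeaf G x
  path-start-leaf e p unique onPath = neighbour-unique⇒IsLeaf G e λ w xw → successor w xw (onPath w xw)
    where
    successor : ∀ w → Adj G _ w → w ∈ʷ e ◅ p → w ≡ _
    successor w xw (here refl) = ⊥-elim (Adj-irrefl G xw)
    successor w xw (there w∈p) = adjacent-on-path≡successor e p unique xw w∈p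

  leafBeyond : ∀ {y a} → Adj G y a → ∃[ z ] IsLeaf G z × Σ (Star (Adj G) z y) (a ∉ʷ_)
  leafBeyond {y} {a} ya = grow n ε (((λ { refl → Adj-irrefl G ya }) ∷ []) ∷ [] ∷ []) (m≤m+n n 2)
    where
    toA : ∀ {x} → Star (Adj G) x y → Star (Adj G) x a
    toA q = q ◅◅ ya ◅ ε

    start-leaf : ∀ {x} (q : Star (Adj G) x y) → Unique (vertices (toA q)) →
                 (∀ w → Adj G x w → w ∈ʷ toA q) → IsLeaf G x
    start-leaf ε       = path-start-leaf ya ε
    start-leaf (e ◅ q) = path-start-leaf e (toA q)

    -- Extend q backwards, away from a, while its start has a neighbour off the path; a path has
    -- at most n vertices, so the fuel never runs out.
    grow : ∀ fuel {x} (q : Star (Adj G) x y) → Unique (vertices (toA q)) →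
           n ≤ fuel + length (vertices (toA q)) →
           ∃[ z ] IsLeaf G z × Σ (Star (Adj G) z y) (a ∉ʷ_)
    grow fuel {x} q unique bound with any? (λ w → Adj? G x w ×-dec ¬? (w ∈ʷ? toA q))
    ... | no none = x , start-leaf q unique onPath , q , end∉ʷ-init q ya unique
      where
      onPath : ∀ w → Adj G x w → w ∈ʷ toA q
      onPath w xw = decidable-stable (w ∈ʷ? toA q) λ w∉ → none (w , xw , w∉)
    grow zero       q unique bound | yes (w , xw , w∉) =
      ⊥-elim (<-irrefl refl (≤-trans (Unique⇒length≤ (¬Any⇒All¬ _ w∉ ∷ unique)) bound))
    grow (suc fuel) q unique bound | yes (w , xw , w∉) =
      grow fuel (Adj-sym G xw ◅ q) (¬Any⇒All¬ _ w∉ ∷ unique) (subst (n ≤_) (sym (+-suc fuel _)) bound)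

separates-asym : ∀ {n} {G : Graph n} → Connected G → ∀ {a a′ z} → a ≢ a′ →
                 Separates G a z a′ → Separates G a′ z a → ⊥
separates-asym connected a≢a′ sep sep′ with avoidOneOf a≢a′ (connected _ _)
... | inj₁ (p , a∉p)  = a∉p (sep p)
... | inj₂ (p , a′∉p) = a′∉p (sep′ p)

¬¬-separatingNeighbour : ∀ {n} {G : Graph n} → IsTree G → ∀ {a b} → a ≢ b → ¬ IsLeaf G a →
                         ¬ ¬ (∃[ y ] Adj G a y × Separates G a y b)
¬¬-separatingNeighbour {G = G} (connected , acyclic) {a} {b} a≢b ¬leaf with connected a b
... | ε = ⊥-elim (a≢b refl)
... | _◅_ {j = y₁} ay₁ _ with any? (λ w → Adj? G a w ×-dec ¬? (w ≟ y₁))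
...   | no none = ⊥-elim (¬leaf (neighbour-unique⇒IsLeaf G ay₁ λ w aw →
                    decidable-stable (w ≟ y₁) λ w≢y₁ → none (w , aw , w≢y₁)))
...   | yes (y₂ , ay₂ , y₂≢y₁) = λ notFound → ¬¬-excluded-middle {A = Separates G a y₁ b} λ where
        (yes sep₁) → notFound (y₁ , ay₁ , sep₁)
        (no ¬sep₁) → notFound (y₂ , ay₂ , λ p → decidable-stable (a ∈ʷ? p)
                        λ a∉p → ¬sep₁ (sibling-separates {G = G} acyclic ay₁ ay₂ (≢-sym y₂≢y₁) p a∉p))

-- Steiner trees

module _ {n} {G : Graph n} where

  SubAdj : Subgraph G → Fin n → Fin n → Set
  SubAdj H i j = edge H i j ≡ true

  walk-in-subgraph : ∀ (H : Subgraph G) {x y v} (p : Star (SubAdj H) x y) →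
                     y ∈ verts H → v ∈ʷ p → v ∈ verts H
  walk-in-subgraph H ε         y∈H (here refl) = y∈H
  walk-in-subgraph H (xx₁ ◅ p) y∈H (here refl) = edge-in H _ _ xx₁
  walk-in-subgraph H (_ ◅ p)   y∈H (there v∈)  = walk-in-subgraph H p y∈H v∈

  -- edgeCount unfolds to a pairCount, each edge counted once by ordering its ends by toℕ.
  edgeCount-<-ordered : ∀ {H′ H : Subgraph G} {u w} → toℕ u < toℕ w →
                        (∀ i j → edge H′ i j ≡ true → edge H i j ≡ true) →
                        edge H u w ≡ true → edge H′ u w ≡ false → edgeCount H′ < edgeCount H
  edgeCount-<-ordered u<w H′⊆H uw ¬uw′ =
    pairCount-< (λ i j → ∧-monoʳ-true (H′⊆H i j) (toℕ i <ᵇ toℕ j))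
      (cong₂ _∧_ (Equivalence.to T-≡ (<⇒<ᵇ u<w)) uw) (trans (cong (_ ∧_) ¬uw′) (∧-zeroʳ _))

  edgeCount-< : ∀ {H′ H : Subgraph G} {u w} → (∀ i j → edge H′ i j ≡ true → edge H i j ≡ true) →
                edge H u w ≡ true → edge H′ u w ≡ false → edgeCount H′ < edgeCount H
  edgeCount-< {H′} {H} {u} {w} H′⊆H uw ¬uw′ with ℕ.<-cmp (toℕ u) (toℕ w)
  ... | tri< u<w _ _ = edgeCount-<-ordered {H′} {H} u<w H′⊆H uw ¬uw′
  ... | tri> _ _ w<u =
    edgeCount-<-ordered {H′} {H} w<u H′⊆H (trans (edge-sym H w u) uw) (trans (edge-sym H′ w u) ¬uw′)
  ... | tri≈ _ u≡w _ rewrite toℕ-injective u≡w = ⊥-elim (Adj-irrefl G (edge-adj H w w uw))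

  completeSubgraph : Subgraph G
  completeSubgraph = record
    { verts    = ⊤
    ; edge     = adj G
    ; edge-sym = Graph.sym G
    ; edge-adj = λ _ _ ij → ij
    ; edge-in  = λ _ _ _ → ∈⊤
    }

  ¬¬-steinerTree-below : ∀ W m (H : Subgraph G) → ConnContaining W H → edgeCount H < m →
                          ¬ ¬ Σ (Subgraph G) (IsSteinerTree G W)
  ¬¬-steinerTree-below W (suc m) H spans (s≤s H≤m) noTree =
    ¬¬-excluded-middle {A = ∃[ H′ ] ConnContaining W H′ × edgeCount H′ < edgeCount H} λ where
    (yes (H′ , spans′ , H′<H)) → ¬¬-steinerTree-below W m H′ spans′ (<-≤-trans H′<H H≤m) noTree
    (no  noSmaller)            →
      noTree (H , spans , λ H′ spans′ → ≮⇒≥ λ H′<H → noSmaller (H′ , spans′ , H′<H))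

  ¬¬-steinerTree : Connected G → ∀ W → ¬ ¬ Σ (Subgraph G) (IsSteinerTree G W)
  ¬¬-steinerTree connected W =
    ¬¬-steinerTree-below W _ completeSubgraph ((λ u w _ _ → connected u w) , λ _ → ∈⊤) (n<1+n _)

  deleteVertex : Subgraph G → Fin n → Subgraph G
  deleteVertex H v = record
    { verts    = verts H - v
    ; edge     = λ i j → edge H i j ∧ (i ≢ᵇ v ∧ j ≢ᵇ v)
    ; edge-sym = λ i j → cong₂ _∧_ (edge-sym H i j) (Bool.∧-comm (i ≢ᵇ v) (j ≢ᵇ v))
    ; edge-adj = λ i j ij → edge-adj H i j (∧-conicalˡ (edge H i j) _ ij)
    ; edge-in  = λ i j ij → x∈p∧x≢y⇒x∈p-y (edge-in H i j (∧-conicalˡ (edge H i j) _ ij))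
                              (≢ᵇ⇒≢ (∧-conicalˡ (i ≢ᵇ v) (j ≢ᵇ v) (∧-conicalʳ (edge H i j) _ ij)))
    }

  deleteVertex-fewerEdges : ∀ H {v x} → edge H v x ≡ true → edgeCount (deleteVertex H v) < edgeCount H
  deleteVertex-fewerEdges H {v} {x} vx =
    edgeCount-< {deleteVertex H v} {H} (λ i j → ∧-conicalˡ (edge H i j) _) vx
    (trans (cong (λ b → edge H v x ∧ (b ∧ x ≢ᵇ v)) (cong not (dec-true (v ≟ v) refl))) (∧-zeroʳ _))

  -- A vertex with at most one neighbour is never interior to a path.
  deleteVertex-connected : ∀ H {v} → SubConnected H → (∀ {a b} → Adj G v a → Adj G v b → a ≡ b) →
                           SubConnected (deleteVertex H v)
  deleteVertex-connected H {v} connected atMostOne u w u∈ w∈ =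
    restrictWalk keep p (All.tabulate λ {x} x∈p → avoids x∈p)
    where
    u∈H,u≢v = x∈p-y⁻ u∈
    w∈H,w≢v = x∈p-y⁻ w∈
    q = connected u w (proj₁ u∈H,u≢v) (proj₁ w∈H,w≢v)
    p = toPath q
    avoids : ∀ {x} → x ∈ʷ p → x ≢ v
    avoids x∈p refl
      with interior-neighbours p (toPath-unique q) x∈p (≢-sym (proj₂ u∈H,u≢v)) (≢-sym (proj₂ w∈H,w≢v))
    ... | a , b , av , vb , a≢b =
      a≢b (atMostOne (Adj-sym G (edge-adj H _ _ av)) (edge-adj H _ _ vb))
    keep : ∀ {a b} → SubAdj H a b → a ≢ v → b ≢ v → SubAdj (deleteVertex H v) a b
    keep ab a≢v b≢v = cong₂ _∧_ ab (cong₂ _∧_ (≢⇒≢ᵇ a≢v) (≢⇒≢ᵇ b≢v))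

  steinerTree-leaf∈ : ∀ {W T v} → IsSteinerTree G W T → Nonempty W → v ∈ verts T → IsLeaf G v → v ∈ W
  steinerTree-leaf∈ {W} {T} {v} ((connected , W⊆T) , minimal) (b , b∈W) v∈T leaf with v ∈? W
  ... | yes v∈W = v∈W
  ... | no  v∉W =
    ⊥-elim (<⇒≱ (deleteVertex-fewerEdges T (proj₂ (firstEdge (connected v b v∈T (W⊆T b∈W)) b∈W)))
                (minimal (deleteVertex T v) (T-v-connected , W⊆T-v)))
    where
    firstEdge : ∀ {y} → Star (SubAdj T) v y → y ∈ W → ∃[ x ] SubAdj T v x
    firstEdge ε        v∈W = ⊥-elim (v∉W v∈W)
    firstEdge (vx ◅ _) _   = _ , vx
    T-v-connected = deleteVertex-connected T connected (leaf-neighbour-unique G leaf)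
    W⊆T-v : W ⊆ verts (deleteVertex T v)
    W⊆T-v x∈W = x∈p∧x≢y⇒x∈p-y (W⊆T x∈W) λ { refl → v∉W x∈W }

separator∈steinerTree : ∀ {n} {G : Graph n} {W T a u w} → IsSteinerTree G W T → u ∈ W → w ∈ W →
                        Separates G a u w → a ∈ verts T
separator∈steinerTree {T = T} {a} ((connected , W⊆T) , _) u∈W w∈W separates =
  walk-in-subgraph T p (W⊆T w∈W) (subst (a ∈ˡ_) (vertices-map toG p) (separates (Star.map toG p)))
  where
  p = connected _ _ (W⊆T u∈W) (W⊆T w∈W)
  toG : ∀ {i j} → SubAdj T i j → _
  toG {i} {j} = edge-adj T i j

-- Steiner general position sets

steinerTree-∩ : ∀ {n} {G : Graph n} {A B T} → B ⊆ A → IsSteinerTree G B T →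
                verts T ∩ A ⊆ B → verts T ∩ A ≡ B
steinerTree-∩ B⊆A ((_ , B⊆T) , _) T∩A⊆B = ⊆-antisym T∩A⊆B λ x∈B → x∈p∩q⁺ (B⊆T x∈B , B⊆A x∈B)

leafSet-isSGP : ∀ {n} (G : Graph n) {k} → 1 ≤ k → IsSGPSet k G (leafSet G)
leafSet-isSGP G 1≤k B B⊆L ∣B∣≡k T steiner = steinerTree-∩ {G = G} {T = T} B⊆L steiner λ x∈ →
  let x∈T , x∈L = x∈p∩q⁻ (verts T) (leafSet G) x∈ in
  steinerTree-leaf∈ {G = G} {W = B} {T = T} steiner (1≤∣p∣⇒Nonempty (subst (1 ≤_) (sym ∣B∣≡k) 1≤k))
    x∈T (∈-leafSet⁻ G x∈L)

ofSize-isSGP : ∀ {n} (G : Graph n) {k A} → ∣ A ∣ ≡ k → IsSGPSet k G A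
ofSize-isSGP G ∣A∣≡k B B⊆A ∣B∣≡k T steiner = steinerTree-∩ {G = G} {T = T} B⊆A steiner λ x∈ →
  ⊆∧∣∣≤⇒⊇ B⊆A (≤-reflexive (trans ∣A∣≡k (sym ∣B∣≡k))) (proj₂ (x∈p∩q⁻ (verts T) _ x∈))

module UpperBound {n} {G : Graph n} (tree : IsTree G) {k} (2≤k : 2 ≤ k)
                  {A : Subset n} (sgp : IsSGPSet k G A) (k<∣A∣ : k < ∣ A ∣) where

  k≤∣A-a∣ : ∀ {a} → a ∈ A → k ≤ ∣ A - a ∣
  k≤∣A-a∣ a∈A = ≤-pred (subst (k <_) (∣p∣≡1+∣p-x∣ a∈A) k<∣A∣)

  no-separator : ∀ {a u w} → a ∈ A → u ∈ A → w ∈ A → u ≢ a → w ≢ a → ¬ Separates G a u w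
  no-separator {a} {u} {w} a∈A u∈A w∈A u≢a w≢a separates
    with B , uw⊆B , B⊆A-a , ∣B∣≡k ← between {d = ⁅ u ⁆ ∪ ⁅ w ⁆}
                                      (⁅x⁆∪⁅y⁆⊆p (x∈p∧x≢y⇒x∈p-y u∈A u≢a) (x∈p∧x≢y⇒x∈p-y w∈A w≢a))
                                      (≤-trans (∣⁅x⁆∪⁅y⁆∣≤2 u w) 2≤k)
                                      (k≤∣A-a∣ a∈A)
    = ¬¬-steinerTree (proj₁ tree) B λ (T , steiner) →
        proj₂ (x∈p-y⁻ (B⊆A-a (a∈B T steiner))) refl
    where
    a∈B : ∀ T → IsSteinerTree G B T → a ∈ B
    a∈B T steiner = subst (a ∈_) (sgp B (λ x∈B → proj₁ (x∈p-y⁻ (B⊆A-a x∈B))) ∣B∣≡k T steiner)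
      (x∈p∩q⁺ (separator∈steinerTree {G = G} {T = T} steiner (uw⊆B (x∈p∪q⁺ {q = ⁅ w ⁆} (inj₁ (x∈⁅x⁆ u))))
                 (uw⊆B (x∈p∪q⁺ {p = ⁅ u ⁆} (inj₂ (x∈⁅x⁆ w))))
                 separates , a∈A))

  otherMember : ∀ {a} → a ∈ A → ∃[ b ] b ∈ A × b ≢ a
  otherMember a∈A with b , b∈A-a ← 1≤∣p∣⇒Nonempty (≤-trans (s≤s z≤n) (≤-trans 2≤k (k≤∣A-a∣ a∈A)))
    = b , x∈p-y⁻ b∈A-a

  PrivateLeaf : Fin n → Fin n → Set
  PrivateLeaf a z = IsLeaf G z × (∀ c → c ∈ A → c ≢ a → Separates G a z c)

  ¬¬-privateLeaf : ∀ {a} → a ∈ A → ¬ ¬ ∃ (PrivateLeaf a)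
  ¬¬-privateLeaf {a} a∈A with otherMember a∈A | degree G a ℕ.≟ 1
  ... | _              | yes leaf = λ noLeaf → noLeaf (a , leaf , λ _ _ _ _ → here refl)
  ... | b , b∈A , b≢a | no ¬leaf = ¬¬-map beyond (¬¬-separatingNeighbour {G = G} tree (≢-sym b≢a) ¬leaf)
    where
    beyond : ∃[ y ] Adj G a y × Separates G a y b → ∃ (PrivateLeaf a)
    beyond (y , ay , separates) with z , leaf , q , a∉q ← leafBeyond {G = G} (proj₂ tree) (Adj-sym G ay)
      = z , leaf , λ c c∈A c≢a p → decidable-stable (a ∈ʷ? p) λ a∉p →
          no-separator a∈A c∈A b∈A c≢a b≢a (separates-transfer G separates (reverse (Adj-sym G) q ◅◅ p)
            (∉ʷ-◅◅ (∉ʷ-reverse (Adj-sym G) a∉q) a∉p))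

  privateLeaf-injective : ∀ {a a′ z} → a ∈ A → a′ ∈ A → PrivateLeaf a z → PrivateLeaf a′ z → a ≡ a′
  privateLeaf-injective {a} {a′} a∈A a′∈A (_ , separates) (_ , separates′) with a ≟ a′
  ... | yes a≡a′ = a≡a′
  ... | no  a≢a′ = ⊥-elim (separates-asym {G = G} (proj₁ tree) a≢a′
                      (separates a′ a′∈A (≢-sym a≢a′)) (separates′ a a∈A a≢a′))

  -- Private leaves are found only under double negation (separation is not decided here);
  -- this suffices because the goal is decidable.
  ∣A∣≤leaves : ∣ A ∣ ≤ leaves G
  ∣A∣≤leaves =
    decidable-stable (∣ A ∣ ≤? leaves G) (¬¬-map count (¬¬-choice (_∈? A) (λ _ → ¬¬-privateLeaf)))
    where
    count : (∀ a → a ∈ A → ∃ (PrivateLeaf a)) → ∣ A ∣ ≤ leaves G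
    count leafOf = subst (∣ A ∣ ≤_) (sym (leaves≡∣leafSet∣ G))
      (card-≤-injection (⊂-wellFounded A) (λ a a∈A → proj₁ (leafOf a a∈A))
        (λ a a∈A → ∈-leafSet⁺ G (proj₁ (proj₂ (leafOf a a∈A))))
        λ a a′ a∈A a′∈A same → privateLeaf-injective a∈A a′∈A (proj₂ (leafOf a a∈A))
                                 (subst (PrivateLeaf a′) (sym same) (proj₂ (leafOf a′ a′∈A))))

sgp-upperBound : ∀ {n} {G : Graph n} → IsTree G → ∀ {k} → 2 ≤ k → ∀ {A} → IsSGPSet k G A →
                 ∣ A ∣ ≤ k ⊔ leaves G
sgp-upperBound {G = G} tree {k} 2≤k {A} sgp with k <? ∣ A ∣
... | yes k<∣A∣ = ≤-trans (UpperBound.∣A∣≤leaves tree 2≤k sgp k<∣A∣) (m≤n⊔m k (leaves G))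
... | no  k≮∣A∣ = ≤-trans (≮⇒≥ k≮∣A∣) (m≤m⊔n k (leaves G))

theorem3p1 : ∀ (n : ℕ) (T : Graph n) → IsTree T → 3 ≤ n →
    ∀ (k : ℕ) → 2 ≤ k → k < n →
      ((k ≤ leaves T → IsSgp k T (leaves T)) × (leaves T < k → IsSgp k T k))
theorem3p1 n T tree _ k 2≤k k<n = sgp≡leaves , sgp≡k
  where
  -- The hypothesis 3 ≤ n is implied by 2 ≤ k < n.
  sgp≡leaves : k ≤ leaves T → IsSgp k T (leaves T)
  sgp≡leaves k≤ℓ =
    (leafSet T , leafSet-isSGP T (≤-trans (s≤s z≤n) 2≤k) , sym (leaves≡∣leafSet∣ T)) ,
    λ A sgp → subst (∣ A ∣ ≤_) (m≤n⇒m⊔n≡n k≤ℓ) (sgp-upperBound tree 2≤k sgp)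
  sgp≡k : leaves T < k → IsSgp k T k
  sgp≡k ℓ<k with B , ∣B∣≡k ← subset-ofSize (<⇒≤ k<n) =
    (B , ofSize-isSGP T ∣B∣≡k , ∣B∣≡k) ,
    λ A sgp → subst (∣ A ∣ ≤_) (m≥n⇒m⊔n≡m (<⇒≤ ℓ<k)) (sgp-upperBound tree 2≤k sgp)
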